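{- In LP$^{\mathrm{MLN}}$ (i.e. with respect to semi-strong equivalence $\equiv_{s,s}$), the S-DL transformation is NSE-preserving: for every pair $T=\langle P,Q\rangle$ of programs with $P\not\equiv_{s,s}Q$, every independent set $I$ of $T$ with $|I|\ge 3$ and every $a\in I$, the pair $\langle P^-,Q^-\rangle$ obtained from $T$ by deleting $a$ from $I$ satisfies $P^-\not\equiv_{s,s}Q^-$.
   Context: Atoms are propositional. A rule $r$ is an expression $h_1\vee\cdots\vee h_k\leftarrow b_1,\dots,b_m,\mathit{not}\,c_1,\dots,\mathit{not}\,c_n$; write $H(r)$, $B^+(r)$, $B^-(r)$ for the sets of head, positive body and negative body atoms. A program is a finite set of rules. An interpretation $X$ (set of atoms) satisfies $r$ iff $X\cap H(r)\neq\emptyset$ or $B^+(r)\not\subseteq X$ or $B^-(r)\cap X\neq\emptyset$. GL-reduct $P^X=\{H(r)\leftarrow B^+(r) : r\in P,\ B^-(r)\cap X=\emptyset\}$; $X$ is an ASP stable model of $P$ iff $X\models P^X$ and no proper subset of $X$ satisfies $P^X$. Weights of LP$^{\mathrm{MLN}}$ rules are omitted; $X$ is an LP$^{\mathrm{MLN}}$ stable model of $P$ iff $X$ is an ASP stable model of $\{r\in P: X\models r\}$. $P\equiv_{s,s}Q$ iff for every program $R$, $P\cup R$ and $Q\cup R$ have the same LP$^{\mathrm{MLN}}$ stable models. Programs are regarded as tuples of rules; $\langle P,Q\rangle$ is the concatenation of $P$ and $Q$. For a tuple $T=\langle r_1,\dots,r_n\rangle$ let $\langle S_1,\dots,S_{3n}\rangle=\langle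 H(r_1),B^+(r_1),B^-(r_1),\dots,H(r_n),B^+(r_n),B^-(r_n)\rangle$. For nonempty $N'\subseteq\{1,\dots,3n\}$ the independent set is $I_{N'}=\bigcap_{i\in N'}S_i\setminus\bigcup_{j\notin N'}S_j$. Deleting $a\in I$ from $I$ means removing the atom $a$ from every rule of $T$; the resulting tuple is split as $\langle P^-,Q^-\rangle$ with $P^-$ the first $|P|$ rules. -}

module Defs where

open import Data.Nat using (ℕ; _≟_)
open import Data.Bool using (Bool; true; false; T; not; _∧_; _∨_)
import Data.Bool as B
open import Data.Bool.ListAction using (any; all)
open import Data.List using (List; []; _∷_; _++_; map; length; concatMap; lookup; filterᵇ; deduplicate)
open import Data.List.Relation.Unary.All using (All)
open import Data.Fin using (Fin)
import Data.Vec as V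
open import Data.Fin.Subset using (Subset)
open import Data.Product using (_×_; ∃)
open import Relation.Nullary using (¬_; ⌊_⌋)

Atom : Set
Atom = ℕ

-- A rule  h1 ∨ … ∨ hk ← b1,…,bm, not c1,…,not cn
record Rule : Set where
  constructor rule
  field
    H  : List Atom
    B⁺ : List Atom
    B⁻ : List Atom
open Rule public

Program : Set
Program = List Rule

Interp : Set
Interp = Atom → Bool

satᵇ : Interp → Rule → Bool
satᵇ X r = any X (H r) ∨ not (all X (B⁺ r)) ∨ any X (B⁻ r)

_⊨ʳ_ : Interp → Rule → Set
X ⊨ʳ r = T (satᵇ X r)

_⊨_ : Interp → Program → Set
X ⊨ P = All (X ⊨ʳ_) P

reduct : Program → Interp → Program
reduct [] X = []
reduct (r ∷ P) X with any X (B⁻ r)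
... | true  = reduct P X
... | false = rule (H r) (B⁺ r) [] ∷ reduct P X

_⊆ᴵ_ : Interp → Interp → Set
Y ⊆ᴵ X = ∀ a → T (Y a) → T (X a)

_⊂ᴵ_ : Interp → Interp → Set
Y ⊂ᴵ X = Y ⊆ᴵ X × ∃ λ a → T (X a) × ¬ T (Y a)

ASPStable : Program → Interp → Set
ASPStable P X = X ⊨ reduct P X × (∀ Y → Y ⊂ᴵ X → ¬ (Y ⊨ reduct P X))

satisfiedPart : Interp → Program → Program
satisfiedPart X P = filterᵇ (satᵇ X) P

-- LP^MLN stable model (weights omitted)
LPMLNStable : Program → Interp → Set
LPMLNStable P X = ASPStable (satisfiedPart X P) X

_≡ss_ : Program → Program → Set
P ≡ss Q = ∀ (R : Program) (X : Interp) →
  (LPMLNStable (P ++ R) X → LPMLNStable (Q ++ R) X) ×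
  (LPMLNStable (Q ++ R) X → LPMLNStable (P ++ R) X)

-- ⟨S₁,…,S₃ₙ⟩ = ⟨H(r₁),B⁺(r₁),B⁻(r₁),…⟩
sets : Program → List (List Atom)
sets = concatMap (λ r → H r ∷ B⁺ r ∷ B⁻ r ∷ [])

atoms : Program → List Atom
atoms = concatMap (λ r → H r ++ B⁺ r ++ B⁻ r)

memᵇ : Atom → List Atom → Bool
memᵇ a = any (λ b → ⌊ a ≟ b ⌋)

-- a ∈ I_{N'}  iff  for every index i: a ∈ S_i ⇔ i ∈ N'
inIndepᵇ : (T' : Program) → Subset (length (sets T')) → Atom → Bool
inIndepᵇ T' N' a = all (λ i → ⌊ memᵇ a (lookup (sets T') i) B.≟ V.lookup N' i ⌋)
                       (Data.List.allFin (length (sets T')))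

-- the independent set I_{N'} as a duplicate-free list (for N' nonempty,
-- every element of I_{N'} occurs in some S_i, hence in atoms T')
indep : (T' : Program) → Subset (length (sets T')) → List Atom
indep T' N' = deduplicate _≟_ (filterᵇ (inIndepᵇ T' N') (atoms T'))

removeAtom : Atom → List Atom → List Atom
removeAtom a = filterᵇ (λ b → not ⌊ a ≟ b ⌋)

deleteRule : Atom → Rule → Rule
deleteRule a r = rule (removeAtom a (H r)) (removeAtom a (B⁺ r)) (removeAtom a (B⁻ r))

deleteAtom : Atom → Program → Program
deleteAtom a = map (deleteRule a)

module Submission where

-- X is an LP^MLN stable model of P iff no Y ⊂ X satisfies the positive part of every rule of P that
-- X satisfies and whose negative body X avoids. So if X is stable for P ∪ R but not for Q ∪ R, some
-- Y ⊂ X does this for Q ∪ R but not for P. Every set H(r), B⁺(r), B⁻(r) contains all of I or none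
-- of it, and I keeps two atoms b, c besides a; reading X and Y through the map sending b to an atom
-- of I where (X, Y) is least and the rest of I to one where it is greatest yields X' ⊃ Y' on which
-- every rule with a deleted behaves as the original rule on X, Y. Adding the facts of Y' and the
-- rules e ← f for e, f ∈ X' ∖ Y' leaves Y' as the only candidate below X', so X' separates the
-- deleted programs.

open import Defs
open import Data.Nat using (ℕ; suc; _≟_; _≤_; s≤s)
open import Data.Nat.Properties using (1+n≰n)
open import Data.Bool using (Bool; true; false; T; not; _∧_; _∨_; if_then_else_)
open import Data.Bool.ListAction using (any; all; and; or)
open import Data.List using (List; []; _∷_; _++_; map; filterᵇ; length; lookup; cartesianProductWith)
open import Data.List.Properties using (map-cong)
open import Data.List.Extrema.Nat
  using (argmin; argmax; argmin-all; argmax-all; f[argmin]≤f[xs]; f[xs]≤f[argmax]; max; xs≤max)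
open import Data.List.Relation.Unary.All as All using (All; []; _∷_)
import Data.List.Relation.Unary.All.Properties as Allₚ
import Data.List.Relation.Unary.Any as Any
open Any using (here; there)
import Data.List.Relation.Unary.Any.Properties as Anyₚ
open import Data.List.Membership.Propositional using (_∈_; _∉_; find; lose)
open import Data.List.Membership.DecPropositional _≟_ using (_∈?_)
open import Data.List.Membership.Propositional.Properties
  using ( ∈-allFin; ∈-deduplicate⁻; ∈-concatMap⁺; ∈-filter⁺; ∈-filter⁻; ∈-map⁺; ∈-map⁻
        ; ∈-++⁺ˡ; ∈-++⁺ʳ; ∈-++⁻; ∈-cartesianProductWith⁺; ∈-cartesianProductWith⁻)
open import Data.List.Relation.Unary.AllPairs using (_∷_)
open import Data.List.Relation.Unary.Unique.Propositional using (Unique)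
open import Data.List.Relation.Unary.Unique.DecPropositional.Properties _≟_ using (deduplicate-!)
open import Data.Fin.Subset using (Subset; Nonempty)
import Data.Vec as Vec
open import Data.Product using (_×_; _,_; ∃; ∃₂; proj₁; proj₂)
open import Data.Sum using (_⊎_; inj₁; inj₂)
open import Data.Unit using (tt)
open import Data.Empty using (⊥-elim)
open import Function using (_∘_; id; _⇔_; mk⇔; Equivalence)
open import Relation.Nullary using (¬_; yes; no; ⌊_⌋; contradiction)
open import Relation.Nullary.Decidable using (T?; toWitness; fromWitness; fromWitnessFalse)
open import Relation.Binary.PropositionalEquality
  using (_≡_; _≢_; _≗_; refl; sym; trans; cong; cong₂; subst)

T⇔→≡ : ∀ {x y} → (T x → T y) → (T y → T x) → x ≡ y
T⇔→≡ {true}  {true}  _ _ = refl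
T⇔→≡ {true}  {false} f _ = ⊥-elim (f tt)
T⇔→≡ {false} {true}  _ g = ⊥-elim (g tt)
T⇔→≡ {false} {false} _ _ = refl

memᵇ⇔∈ : ∀ {e S} → T (memᵇ e S) ⇔ e ∈ S
memᵇ⇔∈ = mk⇔ (Any.map toWitness ∘ Anyₚ.any⁻ _ _) (Anyₚ.any⁺ _ ∘ Any.map fromWitness)

∈-removeAtom⁺ : ∀ {a e S} → e ∈ S → a ≢ e → e ∈ removeAtom a S
∈-removeAtom⁺ e∈S a≢e = ∈-filter⁺ (T? ∘ _) e∈S (fromWitnessFalse a≢e)

∈-removeAtom⁻ : ∀ {a e} S → e ∈ removeAtom a S → e ∈ S
∈-removeAtom⁻ {a} S = proj₁ ∘ ∈-filter⁻ (T? ∘ λ b → not ⌊ a ≟ b ⌋)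

positivePart : Rule → Rule
positivePart r = rule (H r) (B⁺ r) []

ReductSat : Interp → Interp → Rule → Set
ReductSat X Y r = X ⊨ʳ r → ¬ T (any X (B⁻ r)) → Y ⊨ʳ positivePart r

ReductModel : Interp → Program → Interp → Set
ReductModel X P Y = All (ReductSat X Y) P

⊨reduct⇔ReductModel : ∀ X Y P → Y ⊨ reduct (satisfiedPart X P) X ⇔ ReductModel X P Y
⊨reduct⇔ReductModel X Y P = mk⇔ (to P) (from P)
  where
  to : ∀ P → Y ⊨ reduct (satisfiedPart X P) X → ReductModel X P Y
  to [] _ = []
  to (r ∷ P) ⊨R with satᵇ X r in sat
  ... | false = (λ s → ⊥-elim (subst T sat s)) ∷ to P ⊨R
  ... | true with any X (B⁻ r) in hit
  ...   | true  = (λ _ ¬hit → ⊥-elim (¬hit (subst T (sym hit) tt))) ∷ to P ⊨R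
  ...   | false = (λ _ _ → All.head ⊨R) ∷ to P (All.tail ⊨R)
  from : ∀ P → ReductModel X P Y → Y ⊨ reduct (satisfiedPart X P) X
  from [] _ = []
  from (r ∷ P) (Yr ∷ YP) with satᵇ X r
  ... | false = from P YP
  ... | true with any X (B⁻ r)
  ...   | true  = from P YP
  ...   | false = Yr tt (λ ()) ∷ from P YP

ReductSat-refl : ∀ X r → ReductSat X X r
ReductSat-refl X r s ¬hit with any X (H r) | all X (B⁺ r) | any X (B⁻ r)
... | true  | _     | _     = tt
... | false | false | _     = tt
... | false | true  | true  = ⊥-elim (¬hit tt)
... | false | true  | false = s

LPMLNStable⇔noSmallerReductModel : ∀ P X →
  LPMLNStable P X ⇔ (∀ Y → Y ⊂ᴵ X → ¬ ReductModel X P Y)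
LPMLNStable⇔noSmallerReductModel P X = mk⇔
  (λ (_ , minimal) Y Y⊂X → minimal Y Y⊂X ∘ from)
  (λ noSmaller → from (All.tabulate λ {r} _ → ReductSat-refl X r) ,
                 λ Y Y⊂X → noSmaller Y Y⊂X ∘ to)
  where
  to : ∀ {Y} → Y ⊨ reduct (satisfiedPart X P) X → ReductModel X P Y
  to = Equivalence.to (⊨reduct⇔ReductModel X _ P)
  from : ∀ {Y} → ReductModel X P Y → Y ⊨ reduct (satisfiedPart X P) X
  from = Equivalence.from (⊨reduct⇔ReductModel X _ P)

satᵇ-cong : ∀ {Y Z} → Y ≗ Z → ∀ r → satᵇ Y r ≡ satᵇ Z r
satᵇ-cong {Y} {Z} Y≗Z r =
  cong₂ _∨_ (any-cong (H r)) (cong₂ _∨_ (cong not all-cong) (any-cong (B⁻ r)))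
  where
  any-cong : ∀ S → any Y S ≡ any Z S
  any-cong S = cong or (map-cong Y≗Z S)
  all-cong : all Y (B⁺ r) ≡ all Z (B⁺ r)
  all-cong = cong and (map-cong Y≗Z (B⁺ r))

ReductModel-congʳ : ∀ {X Y Z P} → Y ≗ Z → ReductModel X P Y → ReductModel X P Z
ReductModel-congʳ Y≗Z = All.map λ {r} Yr s ¬hit → subst T (satᵇ-cong Y≗Z (positivePart r)) (Yr s ¬hit)

-- Y is the only model of the reduct of probe strictly below X: the facts force Y ⊆ Z, and the rules
-- e ⇐ f over gap = X ∖ Y make the atoms of X ∖ Y stand or fall together.
module Probe (L : List Atom) (X Y : Interp) (X⊆L : ∀ {e} → T (X e) → e ∈ L) (Y⊆X : Y ⊆ᴵ X) where

  gap : List Atom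
  gap = filterᵇ (λ e → X e ∧ not (Y e)) L

  fact : Atom → Rule
  fact e = rule (e ∷ []) [] []

  _⇐_ : Atom → Atom → Rule
  e ⇐ f = rule (e ∷ []) (f ∷ []) []

  probe : Program
  probe = map fact (filterᵇ Y L) ++ cartesianProductWith _⇐_ gap gap

  ∈gap⁺ : ∀ {e} → T (X e) → ¬ T (Y e) → e ∈ gap
  ∈gap⁺ {e} Xe ¬Ye = ∈-filter⁺ (T? ∘ _) (X⊆L Xe) (X∖Y Xe ¬Ye)
    where
    X∖Y : T (X e) → ¬ T (Y e) → T (X e ∧ not (Y e))
    X∖Y Xe ¬Ye with X e | Y e
    ... | true  | true  = ¬Ye tt
    ... | true  | false = tt

  ∈gap⁻ : ∀ {e} → e ∈ gap → T (X e) × ¬ T (Y e)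
  ∈gap⁻ {e} e∈gap with X e | Y e | proj₂ (∈-filter⁻ (T? ∘ λ e → X e ∧ not (Y e)) {xs = L} e∈gap)
  ... | true | false | _ = tt , λ ()

  ⊨fact⇔ : ∀ Z {e} → Z ⊨ʳ fact e ⇔ T (Z e)
  ⊨fact⇔ Z {e} with Z e
  ... | true  = mk⇔ _ _
  ... | false = mk⇔ (λ ()) (λ ())

  ⊨⇐⇔ : ∀ Z {e f} → Z ⊨ʳ (e ⇐ f) ⇔ (T (Z f) → T (Z e))
  ⊨⇐⇔ Z {e} {f} with Z e | Z f
  ... | true  | _     = mk⇔ _ _
  ... | false | true  = mk⇔ (λ ()) (λ Zf⇒Ze → Zf⇒Ze tt)
  ... | false | false = mk⇔ (λ _ ()) (λ _ → tt)

  probe-rules : ∀ {r} → r ∈ probe →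
    (∃ λ e → r ≡ fact e × T (Y e)) ⊎ (∃₂ λ e f → r ≡ e ⇐ f × e ∈ gap × f ∈ gap)
  probe-rules r∈ with ∈-++⁻ (map fact (filterᵇ Y L)) r∈
  ... | inj₁ r∈facts with ∈-map⁻ fact r∈facts
  ...   | e , e∈ , refl = inj₁ (e , refl , proj₂ (∈-filter⁻ (T? ∘ Y) {xs = L} e∈))
  probe-rules r∈ | inj₂ r∈rules with ∈-cartesianProductWith⁻ _⇐_ gap gap r∈rules
  ...   | e , f , e∈ , f∈ , refl = inj₂ (e , f , refl , e∈ , f∈)

  probe-ReductModel : ReductModel X probe Y
  probe-ReductModel = All.tabulate λ r∈ → λ _ _ → ⊨positivePart r∈
    where
    ⊨positivePart : ∀ {r} → r ∈ probe → Y ⊨ʳ positivePart r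
    ⊨positivePart r∈ with probe-rules r∈
    ... | inj₁ (e , refl , Ye) = Equivalence.from (⊨fact⇔ Y) Ye
    ... | inj₂ (e , f , refl , _ , f∈) = Equivalence.from (⊨⇐⇔ Y) (⊥-elim ∘ proj₂ (∈gap⁻ f∈))

  module _ {Z : Interp} (Zprobe : ReductModel X probe Z) where

    Y⊆Z : Y ⊆ᴵ Z
    Y⊆Z e Ye = Equivalence.to (⊨fact⇔ Z) (All.lookup Zprobe fact∈ X⊨fact λ ())
      where
      fact∈ : fact e ∈ probe
      fact∈ = ∈-++⁺ˡ (∈-map⁺ fact (∈-filter⁺ (T? ∘ Y) (X⊆L (Y⊆X e Ye)) Ye))
      X⊨fact : X ⊨ʳ fact e
      X⊨fact = Equivalence.from (⊨fact⇔ X) (Y⊆X e Ye)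

    gap-closed : ∀ {e f} → e ∈ gap → f ∈ gap → T (Z f) → T (Z e)
    gap-closed {e} {f} e∈ f∈ = Equivalence.to (⊨⇐⇔ Z) (All.lookup Zprobe ⇐∈ X⊨⇐ λ ())
      where
      ⇐∈ : e ⇐ f ∈ probe
      ⇐∈ = ∈-++⁺ʳ (map fact (filterᵇ Y L)) (∈-cartesianProductWith⁺ _⇐_ e∈ f∈)
      X⊨⇐ : X ⊨ʳ (e ⇐ f)
      X⊨⇐ = Equivalence.from (⊨⇐⇔ X) λ _ → proj₁ (∈gap⁻ e∈)

    ⊂X⇒≗Y : Z ⊂ᴵ X → Z ≗ Y
    ⊂X⇒≗Y (Z⊆X , w , Xw , ¬Zw) e = T⇔→≡ Z⇒Y (Y⊆Z e)
      where
      w∈gap : w ∈ gap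
      w∈gap = ∈gap⁺ Xw (¬Zw ∘ Y⊆Z w)
      Z⇒Y : T (Z e) → T (Y e)
      Z⇒Y Ze with T? (Y e)
      ... | yes Ye = Ye
      ... | no ¬Ye = ⊥-elim (¬Zw (gap-closed w∈gap (∈gap⁺ (Z⊆X e Ze) ¬Ye) Ze))

  LPMLNStable-++probe : ∀ {P} → ¬ ReductModel X P Y → LPMLNStable (P ++ probe) X
  LPMLNStable-++probe {P} ¬YP = Equivalence.from (LPMLNStable⇔noSmallerReductModel (P ++ probe) X)
    λ Z Z⊂X ZPprobe → let ZP , Zprobe = Allₚ.++⁻ P ZPprobe in
      ¬YP (ReductModel-congʳ (⊂X⇒≗Y Zprobe Z⊂X) ZP)

AllOrNone : List Atom → List Atom → Set
AllOrNone I S = ∀ {e f} → e ∈ I → f ∈ I → e ∈ S → f ∈ S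

AllOrNoneʳ : List Atom → Rule → Set
AllOrNoneʳ I r = AllOrNone I (H r) × AllOrNone I (B⁺ r) × AllOrNone I (B⁻ r)

Minimizes Maximizes : Interp → List Atom → Atom → Set
Minimizes V I m = ∀ {e} → e ∈ I → T (V m) → T (V e)
Maximizes V I m = ∀ {e} → e ∈ I → T (V e) → T (V m)

record TwoOthers (I : List Atom) (a : Atom) : Set where
  constructor mkTwoOthers
  field
    {b c} : Atom
    b∈I : b ∈ I
    c∈I : c ∈ I
    a≢b : a ≢ b
    a≢c : a ≢ c
    b≢c : b ≢ c

-- After deleting a, the atoms b and c still stand for I in every set meeting I:
-- b carries the least and c the greatest truth value an interpretation takes on I.
module Collapse {I : List Atom} {a : Atom} (a∈I : a ∈ I) (others : TwoOthers I a)
                {lo hi : Atom} (lo∈I : lo ∈ I) (hi∈I : hi ∈ I) where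

  open TwoOthers others

  collapse : Atom → Atom
  collapse e with e ∈? I | e ≟ b
  ... | yes _ | yes _ = lo
  ... | yes _ | no  _ = hi
  ... | no  _ | _     = e

  collapse-b : collapse b ≡ lo
  collapse-b with b ∈? I | b ≟ b
  ... | yes _   | yes _   = refl
  ... | yes _   | no b≢b  = contradiction refl b≢b
  ... | no  b∉I | _       = contradiction b∈I b∉I

  collapse-c : collapse c ≡ hi
  collapse-c with c ∈? I | c ≟ b
  ... | yes _   | yes c≡b = contradiction (sym c≡b) b≢c
  ... | yes _   | no  _   = refl
  ... | no  c∉I | _       = contradiction c∈I c∉I

  collapse-∉ : ∀ {e} → e ∉ I → collapse e ≡ e
  collapse-∉ {e} e∉I with e ∈? I
  ... | yes e∈I = contradiction e∈I e∉I
  ... | no  _   = refl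

  collapse-∈ : ∀ {S e} → AllOrNone I S → e ∈ S → collapse e ∈ S
  collapse-∈ {e = e} uniform e∈S with e ∈? I | e ≟ b
  ... | yes e∈I | yes _ = uniform e∈I lo∈I e∈S
  ... | yes e∈I | no  _ = uniform e∈I hi∈I e∈S
  ... | no  _   | _     = e∈S

  Agree : Interp → Interp → List Atom → Set
  Agree V V' S = ∀ {e} → e ∈ S → V' e ≡ V (collapse e)

  module _ {V V' : Interp} {S : List Atom} (uniform : AllOrNone I S) (agree : Agree V V' S) where

    private
      kept : ∀ {e} → e ∈ S → e ∉ I → e ∈ removeAtom a S
      kept e∈S e∉I = ∈-removeAtom⁺ e∈S λ { refl → e∉I a∈I }

      agree-∉ : ∀ {e} → e ∈ S → e ∉ I → V' e ≡ V e
      agree-∉ e∈S e∉I = trans (agree e∈S) (cong V (collapse-∉ e∉I))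

      collapse-removeAtom : ∀ {e} → e ∈ removeAtom a S → collapse e ∈ S
      collapse-removeAtom = collapse-∈ uniform ∘ ∈-removeAtom⁻ S

      agree-removeAtom : ∀ {e} → e ∈ removeAtom a S → V' e ≡ V (collapse e)
      agree-removeAtom = agree ∘ ∈-removeAtom⁻ S

    any-removeAtom : Maximizes V I hi → any V' (removeAtom a S) ≡ any V S
    any-removeAtom V-max =
      T⇔→≡ (Anyₚ.any⁺ V ∘ to ∘ Anyₚ.any⁻ V' _) (Anyₚ.any⁺ V' ∘ from ∘ Anyₚ.any⁻ V S)
      where
      to : Any.Any (T ∘ V') (removeAtom a S) → Any.Any (T ∘ V) S
      to V'S with find V'S
      ... | e , e∈ , V'e = lose (collapse-removeAtom e∈) (subst T (agree-removeAtom e∈) V'e)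
      from : Any.Any (T ∘ V) S → Any.Any (T ∘ V') (removeAtom a S)
      from VS with find VS
      ... | e , e∈S , Ve with e ∈? I
      ...   | no  e∉I = lose (kept e∈S e∉I) (subst T (sym (agree-∉ e∈S e∉I)) Ve)
      ...   | yes e∈I = lose (∈-removeAtom⁺ c∈S a≢c) (subst T Vhi≡V'c (V-max e∈I Ve))
        where
        c∈S : c ∈ S
        c∈S = uniform e∈I c∈I e∈S
        Vhi≡V'c : V hi ≡ V' c
        Vhi≡V'c = sym (trans (agree c∈S) (cong V collapse-c))

    all-removeAtom : Minimizes V I lo → all V' (removeAtom a S) ≡ all V S
    all-removeAtom V-min =
      T⇔→≡ (Allₚ.all⁻ V ∘ to ∘ Allₚ.all⁺ V' _) (Allₚ.all⁻ V' ∘ from ∘ Allₚ.all⁺ V S)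
      where
      to : All (T ∘ V') (removeAtom a S) → All (T ∘ V) S
      to V'S = All.tabulate λ {e} e∈S → case e e∈S
        where
        case : ∀ e → e ∈ S → T (V e)
        case e e∈S with e ∈? I
        ... | no  e∉I = subst T (agree-∉ e∈S e∉I) (All.lookup V'S (kept e∈S e∉I))
        ... | yes e∈I = V-min e∈I (subst T V'b≡Vlo (All.lookup V'S (∈-removeAtom⁺ b∈S a≢b)))
          where
          b∈S : b ∈ S
          b∈S = uniform e∈I b∈I e∈S
          V'b≡Vlo : V' b ≡ V lo
          V'b≡Vlo = trans (agree b∈S) (cong V collapse-b)
      from : All (T ∘ V) S → All (T ∘ V') (removeAtom a S)
      from VS = All.tabulate λ e∈ →
        subst T (sym (agree-removeAtom e∈)) (All.lookup VS (collapse-removeAtom e∈))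

  Agreeʳ : Interp → Interp → Rule → Set
  Agreeʳ V V' r = Agree V V' (H r) × Agree V V' (B⁺ r) × Agree V V' (B⁻ r)

  satᵇ-deleteRule : ∀ {V V' r} → Minimizes V I lo → Maximizes V I hi →
    AllOrNoneʳ I r → Agreeʳ V V' r → satᵇ V' (deleteRule a r) ≡ satᵇ V r
  satᵇ-deleteRule V-min V-max (uH , uB⁺ , uB⁻) (aH , aB⁺ , aB⁻) =
    cong₂ _∨_ (any-removeAtom uH aH V-max)
              (cong₂ _∨_ (cong not (all-removeAtom uB⁺ aB⁺ V-min)) (any-removeAtom uB⁻ aB⁻ V-max))

  ReductSat-deleteRule : ∀ {X X' Y Y' r} →
    Minimizes X I lo → Maximizes X I hi → Minimizes Y I lo → Maximizes Y I hi →
    AllOrNoneʳ I r → Agreeʳ X X' r → Agreeʳ Y Y' r →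
    ReductSat X' Y' (deleteRule a r) ⇔ ReductSat X Y r
  ReductSat-deleteRule {X} {X'} {Y} {Y'} {r} X-min X-max Y-min Y-max
                       u@(uH , uB⁺ , uB⁻) agreeX@(_ , _ , aXB⁻) (aH , aB⁺ , _) = mk⇔
    (λ Y'r s ¬hit → subst T satY (Y'r (subst T (sym satX) s) (¬hit ∘ subst T hitX)))
    (λ Yr s ¬hit → subst T (sym satY) (Yr (subst T satX s) (¬hit ∘ subst T (sym hitX))))
    where
    satX : satᵇ X' (deleteRule a r) ≡ satᵇ X r
    satX = satᵇ-deleteRule X-min X-max u agreeX
    hitX : any X' (B⁻ (deleteRule a r)) ≡ any X (B⁻ r)
    hitX = any-removeAtom uB⁻ aXB⁻ X-max
    satY : satᵇ Y' (positivePart (deleteRule a r)) ≡ satᵇ Y (positivePart r)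
    satY = satᵇ-deleteRule {r = positivePart r} Y-min Y-max (uH , uB⁺ , λ _ _ ()) (aH , aB⁺ , λ ())

-- When Y ⊆ X, the pairs (X e, Y e) form the chain ff < tf < tt, numbered by level;
-- the excluded pair ft gets a junk level.
level : Bool → Bool → ℕ
level false _     = 0
level true  false = 1
level true  true  = 2

level-mono : ∀ {x y x' y'} → (T y → T x) → level x y ≤ level x' y' → (T x → T x') × (T y → T y')
level-mono {false} {false}                 _   _         = (λ ()) , (λ ())
level-mono {false} {true}                  y⇒x _         = ⊥-elim (y⇒x tt)
level-mono {true}  {false} {false}         _   ()
level-mono {true}  {false} {true}          _   _         = _ , (λ ())
level-mono {true}  {true}  {false}         _   ()
level-mono {true}  {true}  {true}  {false} _   (s≤s ())
level-mono {true}  {true}  {true}  {true}  _   _         = _ , _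

module _ {X Y : Interp} (Y⊆X : Y ⊆ᴵ X) {I : List Atom} {b : Atom} (b∈I : b ∈ I) where

  private
    levelOf : Atom → ℕ
    levelOf e = level (X e) (Y e)

  ∃-common-minimizer : ∃ λ lo → lo ∈ I × Minimizes X I lo × Minimizes Y I lo
  ∃-common-minimizer =
    lo , argmin-all levelOf b∈I (All.tabulate id) , proj₁ ∘ minimal , proj₂ ∘ minimal
    where
    lo : Atom
    lo = argmin levelOf b I
    minimal : ∀ {e} → e ∈ I → (T (X lo) → T (X e)) × (T (Y lo) → T (Y e))
    minimal e∈I = level-mono (Y⊆X lo) (All.lookup (f[argmin]≤f[xs] {f = levelOf} b I) e∈I)

  ∃-common-maximizer : ∃ λ hi → hi ∈ I × Maximizes X I hi × Maximizes Y I hi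
  ∃-common-maximizer =
    hi , argmax-all levelOf b∈I (All.tabulate id) , proj₁ ∘ maximal , proj₂ ∘ maximal
    where
    hi : Atom
    hi = argmax levelOf b I
    maximal : ∀ {e} → e ∈ I → (T (X e) → T (X hi)) × (T (Y e) → T (Y hi))
    maximal {e} e∈I = level-mono (Y⊆X e) (All.lookup (f[xs]≤f[argmax] {f = levelOf} b I) e∈I)

fresh : List Atom → Atom
fresh U = suc (max 0 U)

fresh-∉ : ∀ U → fresh U ∉ U
fresh-∉ U = 1+n≰n ∘ All.lookup (xs≤max 0 U)

glue : List Atom → Interp → Interp → Interp
glue U V W e = if ⌊ e ∈? U ⌋ then V e else W e

glue-∈ : ∀ {U} V W {e} → e ∈ U → glue U V W e ≡ V e
glue-∈ {U} _ _ {e} e∈U with e ∈? U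
... | yes _   = refl
... | no  e∉U = contradiction e∈U e∉U

glue-∉ : ∀ {U} V W {e} → e ∉ U → glue U V W e ≡ W e
glue-∉ {U} _ _ {e} e∉U with e ∈? U
... | yes e∈U = contradiction e∈U e∉U
... | no  _   = refl

ruleAtoms : Rule → List Atom
ruleAtoms r = H r ++ B⁺ r ++ B⁻ r

∈-atoms : ∀ {P r e} → r ∈ P → e ∈ ruleAtoms r → e ∈ atoms P
∈-atoms r∈P e∈r = ∈-concatMap⁺ ruleAtoms (lose r∈P e∈r)

record DeletedCopy (P : Program) (a : Atom) (X Y : Interp) : Set where
  field
    X' Y'      : Interp
    support    : List Atom
    X'⊆support : ∀ {e} → T (X' e) → e ∈ support
    Y'⊂X'      : Y' ⊂ᴵ X'
    transfer   : ∀ {r} → r ∈ P → ReductSat X' Y' (deleteRule a r) ⇔ ReductSat X Y r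

-- X' and Y' are X and Y read through collapse on the atoms of P, plus a fresh atom in X' ∖ Y'
-- so that Y' ⊂ X' even when collapsing identifies the atoms separating Y from X.
deletedCopy : ∀ {P I a X Y} → All (AllOrNoneʳ I) P → a ∈ I → TwoOthers I a → Y ⊆ᴵ X →
  DeletedCopy P a X Y
deletedCopy {P} {a = a} {X} {Y} uniform a∈I others Y⊆X
  with ∃-common-minimizer Y⊆X (TwoOthers.b∈I others) | ∃-common-maximizer Y⊆X (TwoOthers.b∈I others)
... | lo , lo∈I , X-min , Y-min | hi , hi∈I , X-max , Y-max =
  record { X' = X' ; Y' = Y' ; support = d ∷ U ; X'⊆support = X'⊆d∷U
         ; Y'⊂X' = Y'⊆X' , d , X'd , ¬Y'd ; transfer = transfer }
  where
  open Collapse a∈I others lo∈I hi∈I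

  U : List Atom
  U = atoms P
  d : Atom
  d = fresh U
  isD : Interp
  isD e = ⌊ e ≟ d ⌋
  X' Y' : Interp
  X' = glue U (X ∘ collapse) isD
  Y' = glue U (Y ∘ collapse) (λ _ → false)

  X'⊆d∷U : ∀ {e} → T (X' e) → e ∈ d ∷ U
  X'⊆d∷U {e} with e ∈? U
  ... | yes e∈U = λ _ → Any.there e∈U
  ... | no  _   = Any.here ∘ toWitness

  Y'⊆X' : Y' ⊆ᴵ X'
  Y'⊆X' e with e ∈? U
  ... | yes _ = Y⊆X (collapse e)
  ... | no  _ = λ ()

  X'd : T (X' d)
  X'd = subst T (sym (glue-∉ (X ∘ collapse) isD (fresh-∉ U))) (fromWitness refl)

  ¬Y'd : ¬ T (Y' d)
  ¬Y'd = subst T (glue-∉ (Y ∘ collapse) (λ _ → false) (fresh-∉ U))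

  agreeʳ : ∀ V W {r} → r ∈ P → Agreeʳ V (glue U (V ∘ collapse) W) r
  agreeʳ V W {r} r∈P =
    (λ e∈ → glue-∈ (V ∘ collapse) W (∈-atoms r∈P (∈-++⁺ˡ e∈))) ,
    (λ e∈ → glue-∈ (V ∘ collapse) W (∈-atoms r∈P (∈-++⁺ʳ (H r) (∈-++⁺ˡ e∈)))) ,
    (λ e∈ → glue-∈ (V ∘ collapse) W (∈-atoms r∈P (∈-++⁺ʳ (H r) (∈-++⁺ʳ (B⁺ r) e∈))))

  transfer : ∀ {r} → r ∈ P → ReductSat X' Y' (deleteRule a r) ⇔ ReductSat X Y r
  transfer r∈P = ReductSat-deleteRule X-min X-max Y-min Y-max
    (All.lookup uniform r∈P) (agreeʳ X isD r∈P) (agreeʳ Y (λ _ → false) r∈P)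

ReductModel-deleteAtom : ∀ {P a X X' Y Y'} →
  (∀ {r} → r ∈ P → ReductSat X' Y' (deleteRule a r) ⇔ ReductSat X Y r) →
  ReductModel X' (deleteAtom a P) Y' ⇔ ReductModel X P Y
ReductModel-deleteAtom transfer = mk⇔
  (λ M' → All.tabulate λ r∈ → Equivalence.to (transfer r∈) (All.lookup (Allₚ.map⁻ M') r∈))
  (λ M → Allₚ.map⁺ (All.tabulate λ r∈ → Equivalence.from (transfer r∈) (All.lookup M r∈)))

_⊑_ : Program → Program → Set
P ⊑ Q = ∀ R X → LPMLNStable (P ++ R) X → LPMLNStable (Q ++ R) X

deleteAtom-reflects-⊑ : ∀ {P Q I a} → All (AllOrNoneʳ I) (P ++ Q) → a ∈ I → TwoOthers I a →
  deleteAtom a P ⊑ deleteAtom a Q → P ⊑ Q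
deleteAtom-reflects-⊑ {P} {Q} {a = a} uniform a∈I others P⁻⊑Q⁻ R X stablePR =
  Equivalence.from (LPMLNStable⇔noSmallerReductModel (Q ++ R) X) noSmaller
  where
  noSmaller : ∀ Y → Y ⊂ᴵ X → ¬ ReductModel X (Q ++ R) Y
  noSmaller Y Y⊂X YQR =
    Equivalence.to (LPMLNStable⇔noSmallerReductModel (deleteAtom a Q ++ probe) X') stableQ⁻ Y' Y'⊂X'
      (Allₚ.++⁺ (Equivalence.from transferQ (Allₚ.++⁻ˡ Q YQR)) probe-ReductModel)
    where
    open DeletedCopy (deletedCopy {X = X} uniform a∈I others (proj₁ Y⊂X))
    open Probe support X' Y' X'⊆support (proj₁ Y'⊂X')
    transferP : ReductModel X' (deleteAtom a P) Y' ⇔ ReductModel X P Y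
    transferP = ReductModel-deleteAtom (transfer ∘ ∈-++⁺ˡ)
    transferQ : ReductModel X' (deleteAtom a Q) Y' ⇔ ReductModel X Q Y
    transferQ = ReductModel-deleteAtom (transfer ∘ ∈-++⁺ʳ P)
    ¬YP : ¬ ReductModel X P Y
    ¬YP YP = Equivalence.to (LPMLNStable⇔noSmallerReductModel (P ++ R) X) stablePR Y Y⊂X
      (Allₚ.++⁺ YP (Allₚ.++⁻ʳ Q YQR))
    stableQ⁻ : LPMLNStable (deleteAtom a Q ++ probe) X'
    stableQ⁻ = P⁻⊑Q⁻ probe X' (LPMLNStable-++probe (¬YP ∘ Equivalence.to transferP))

Unique⇒TwoOthers : ∀ {xs} → Unique xs → 3 ≤ length xs → ∀ a → TwoOthers xs a
Unique⇒TwoOthers {[]}         _ ()                 _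
Unique⇒TwoOthers {_ ∷ []}     _ (s≤s ())           _
Unique⇒TwoOthers {_ ∷ _ ∷ []} _ (s≤s (s≤s ()))     _
Unique⇒TwoOthers {x₀ ∷ x₁ ∷ x₂ ∷ _} ((x₀≢x₁ ∷ x₀≢x₂ ∷ _) ∷ (x₁≢x₂ ∷ _) ∷ _) _ a
  with a ≟ x₀ | a ≟ x₁
... | yes refl | _        = mkTwoOthers (there (here refl)) (there (there (here refl))) x₀≢x₁ x₀≢x₂ x₁≢x₂
... | no a≢x₀  | yes refl = mkTwoOthers (here refl) (there (there (here refl))) (x₀≢x₁ ∘ sym) x₁≢x₂ x₀≢x₂
... | no a≢x₀  | no a≢x₁  = mkTwoOthers (here refl) (there (here refl)) a≢x₀ a≢x₁ x₀≢x₁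

∈indep⇒memᵇ≡ : ∀ {P N' e} → e ∈ indep P N' → ∀ i → memᵇ e (lookup (sets P) i) ≡ Vec.lookup N' i
∈indep⇒memᵇ≡ {P} {N'} {e} e∈I i = toWitness (All.lookup (Allₚ.all⁺ _ _ e∈I′) (∈-allFin i))
  where
  e∈I′ : T (inIndepᵇ P N' e)
  e∈I′ = proj₂ (∈-filter⁻ (T? ∘ inIndepᵇ P N') {xs = atoms P} (∈-deduplicate⁻ _≟_ _ e∈I))

indep-AllOrNone : ∀ {P N' S} → S ∈ sets P → AllOrNone (indep P N') S
indep-AllOrNone {P} {N'} S∈ {e} {f} e∈I f∈I with Any.index S∈ | Anyₚ.lookup-index S∈
... | i | refl = Equivalence.to memᵇ⇔∈ ∘ subst T sameMembership ∘ Equivalence.from memᵇ⇔∈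
  where
  sameMembership : memᵇ e (lookup (sets P) i) ≡ memᵇ f (lookup (sets P) i)
  sameMembership = trans (∈indep⇒memᵇ≡ {P} {N'} e∈I i) (sym (∈indep⇒memᵇ≡ {P} {N'} f∈I i))

indep-AllOrNoneʳ : ∀ P N' → All (AllOrNoneʳ (indep P N')) P
indep-AllOrNoneʳ P N' = All.tabulate λ r∈ →
  indep-AllOrNone {P} {N'} (∈-sets r∈ (here refl)) ,
  indep-AllOrNone {P} {N'} (∈-sets r∈ (there (here refl))) ,
  indep-AllOrNone {P} {N'} (∈-sets r∈ (there (there (here refl))))
  where
  ∈-sets : ∀ {r S} → r ∈ P → S ∈ H r ∷ B⁺ r ∷ B⁻ r ∷ [] → S ∈ sets P
  ∈-sets r∈ S∈ = ∈-concatMap⁺ _ (lose r∈ S∈)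

-- Nonempty N' is implied by the length bound, as indep only collects atoms occurring in P ++ Q.
lemma2 : (P Q : Program) → ¬ (P ≡ss Q) →
         (N' : Subset (length (sets (P ++ Q)))) → Nonempty N' →
         3 ≤ length (indep (P ++ Q) N') →
         (a : Atom) → a ∈ indep (P ++ Q) N' →
         ¬ (deleteAtom a P ≡ss deleteAtom a Q)
lemma2 P Q P≢Q N' _ 3≤∣I∣ a a∈I P⁻≡Q⁻ = P≢Q λ R X →
  deleteAtom-reflects-⊑ {P} {Q} uniformPQ a∈I others P⁻⊑Q⁻ R X ,
  deleteAtom-reflects-⊑ {Q} {P} uniformQP a∈I others Q⁻⊑P⁻ R X
  where
  P⁻⊑Q⁻ : deleteAtom a P ⊑ deleteAtom a Q
  P⁻⊑Q⁻ R X = proj₁ (P⁻≡Q⁻ R X)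
  Q⁻⊑P⁻ : deleteAtom a Q ⊑ deleteAtom a P
  Q⁻⊑P⁻ R X = proj₂ (P⁻≡Q⁻ R X)
  uniformPQ : All (AllOrNoneʳ (indep (P ++ Q) N')) (P ++ Q)
  uniformPQ = indep-AllOrNoneʳ (P ++ Q) N'
  uniformQP : All (AllOrNoneʳ (indep (P ++ Q) N')) (Q ++ P)
  uniformQP = Allₚ.++⁺ (Allₚ.++⁻ʳ P uniformPQ) (Allₚ.++⁻ˡ P uniformPQ)
  others : TwoOthers (indep (P ++ Q) N') a
  others = Unique⇒TwoOthers (deduplicate-! _) 3≤∣I∣ a
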